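{- Let $k\in\{1,2\}$, take any $W$ with $W^b_k\subseteq W\subseteq W^d_k$, and let $\mathfrak M=\langle\mathfrak F,V\rangle=\langle W,R,V\rangle$ be the submodel of $\mathfrak M^d_k$ on $W$. Let $|\alpha|_W=\{\langle\Gamma,\Delta\rangle\in W\mid\alpha\in\Gamma\}$. Then: (1) for each formula $\alpha$, $|\alpha|_W\in FP_{\mathfrak F}$; (2) (Truth Lemma) for each formula $\alpha$, $|\alpha|_W=\|\alpha\|_{\mathfrak M}$; (3) $\mathfrak F$ is pseudo-symmetric; if $k=1$ then $\mathfrak F$ is pseudo-reflexive; if $k=2$ then $\mathfrak F$ is reflexive.
   Context: Formulas are built from a countable set of propositional letters and $\bot$ using $\land,\lor,\to$; $\neg\alpha:=\alpha\to\bot$, $\top:=\bot\to\bot$. For a frame $\mathfrak F=\langle W,R\rangle$, $X\subseteq W$: $\Box_{\mathfrak F}X=\{w\mid\forall v(wRv\Rightarrow v\in X)\}$, $\Diamond_{\mathfrak F}X=W\setminus\Box_{\mathfrak F}(W\setminus X)$, $\Diamond^{ -1}_{\mathfrak F}X=\{w\mid\exists x\in X,\ xRw\}$, $FP_{\mathfrak F}=\{\Box_{\mathfrak F}X\mid X\subseteq W\}$. Truth sets: $\|p\|=V(p)$, $\|\bot\|=\Box_{\mathfrak F}\emptyset$, $\|\alpha\land\beta\|=\|\alpha\|\cap\|\beta\|$, $\|\alpha\to\beta\|=\Box_{\mathfrak F}((W\setminus\|\alpha\|)\cup\|\beta\|)$, $\|\alpha\lor\beta\|=\Box_{\mathfrak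 F}\Diamond^{ -1}_{\mathfrak F}(\|\alpha\|\cup\|\beta\|)$. Pseudo-reflexive: every $w\in\Box_{\mathfrak F}\emptyset\cup\Diamond_{\mathfrak F}\Box_{\mathfrak F}\Diamond^{ -1}_{\mathfrak F}\{w\}$; pseudo-symmetric: every $w\in\Box_{\mathfrak F}\Diamond_{\mathfrak F}\Box_{\mathfrak F}\Diamond^{ -1}_{\mathfrak F}\{w\}$. Syntax: $\vdash\subseteq Form\times Form$ extended to sets by $\Gamma\vdash\alpha$ iff $\bigwedge\Gamma_0\vdash\alpha$ for finite $\Gamma_0\subseteq\Gamma$ ($\bigwedge\emptyset=\top$); "$\vdash\alpha$" means $\chi\vdash\alpha$ for all $\chi$. Basic rules: (A) $\alpha\vdash\alpha$; (Cut) $\alpha\vdash\beta,\beta\vdash\gamma\Rightarrow\alpha\vdash\gamma$; ($\bot$) $\bot\vdash\alpha$; ($\land$R) $\chi\vdash\alpha,\chi\vdash\beta\Rightarrow\chi\vdash\alpha\land\beta$; ($\land$L) $\alpha\land\beta\vdash\alpha$, $\alpha\land\beta\vdash\beta$; ($\lor$R) $\alpha\vdash\alpha\lor\beta$, $\beta\vdash\alpha\lor\beta$; ($\lor$L) $\alpha\vdash\chi,\beta\vdash\chi\Rightarrow\alpha\lor\beta\vdash\chi$; (DT$_0$) $\alpha\vdash\beta\Rightarrow\ \vdash\alpha\to\beta$; ($\to\land$) $(\alpha\to\beta)\land(\alpha\to\gamma)\vdash\alpha\to\beta\land\gamma$; ($\to$tr) $(\alpha\to\beta)\land(\beta\to\gamma)\vdash\alpha\to\gamma$;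 ($\to$-$\lor$.s) for $n\ge1$, $\bigvee_j(\alpha_j\to\beta_j)\land\bigwedge_j(\psi_j\land\beta_j\to\chi)\vdash\bigwedge_j(\psi_j\land\alpha_j)\to\chi$. Further: (Abs) $\alpha\land\neg\alpha\vdash\bot$; ($\neg\neg$I) $\alpha\vdash\neg\neg\alpha$; (Refl$_1$) if $\psi_j\land\beta_j\vdash\chi$ for all $j\le n$ then $\bigwedge_j(\psi_j\land\alpha_j)\land\bigvee_j(\alpha_j\to\beta_j)\vdash\chi$; (Refl$_2$) $\bigwedge_j(\psi_j\land\beta_j\to\chi)\vdash\bigwedge_j(\psi_j\land\alpha_j)\land\bigvee_j(\alpha_j\to\beta_j)\to\chi$. i-formulas are $\Delta\sqsupset\Theta$ ($\Delta,\Theta$ non-empty finite); $\Vdash_1$ is the least relation satisfying (A) $\Gamma^i\cup\{\alpha^i\}\Vdash\alpha^i$, (Cut) $\Gamma^i\Vdash\alpha^i,\Phi^i\cup\{\alpha^i\}\Vdash\beta^i\Rightarrow\Gamma^i\cup\Phi^i\Vdash\beta^i$, (i-A) $\Delta\cap\Theta\neq\emptyset\Rightarrow\ \Vdash\Delta\sqsupset\Theta$, (i-Cut) $\{\Delta_1\sqsupset\Theta_1\cup\{\varphi\},\Delta_2\cup\{\varphi\}\sqsupset\Theta_2\}\Vdash\Delta_1\cup\Delta_2\sqsupset\Theta_1\cup\Theta_2$, (i-$\land$L) $\Vdash\{\varphi\land\psi\}\sqsupset\{\varphi\}$, $\Vdash\{\varphi\land\psi\}\sqsupset\{\psi\}$,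 (i-$\land$R) $\Vdash\{\varphi,\psi\}\sqsupset\{\varphi\land\psi\}$; $\Vdash^\gamma_2$ adds ($\gamma$-Refl) $\Vdash\{\varphi_1,\dots,\varphi_n,\bigvee_j(\varphi_j\to\psi_j)\lor\gamma\}\sqsupset\{\psi_1,\dots,\psi_n\}$. $i_\gamma(\Gamma)=\{\{\varphi_1..\varphi_n\}\sqsupset\{\psi_1..\psi_n\}\mid\bigvee_j(\varphi_j\to\psi_j)\lor\gamma\in\Gamma\}$, $Th_\vdash(\alpha)=\{\varphi\mid\alpha\vdash\varphi\}$. $\vdash_1$: least relation with basic rules, (Abs), ($\neg\neg$I), (Prop$_1$) [$i_\gamma(Th_\vdash(\alpha))\Vdash_1\{\top\}\sqsupset\{\bot\}\Rightarrow\alpha\vdash\gamma$]. $\vdash_2$: least relation with basic rules, ($\neg\neg$I), (Refl$_1$), (Refl$_2$), (Prop$_2$) [$i_\gamma(Th_\vdash(\alpha))\Vdash^\gamma_2\{\top\}\sqsupset\{\bot\}\Rightarrow\alpha\vdash\gamma$]. Canonical structures: $\Gamma$ is $\vdash$-closed iff $\{\alpha\mid\Gamma\vdash\alpha\}\subseteq\Gamma$; $\Delta$ is $\vdash$-downward closed iff $\beta\in\Delta$ and $\alpha\vdash\beta$ imply $\alpha\in\Delta$; $\neg(\Gamma)=\{\neg\alpha\mid\alpha\in\Gamma\}$, ${\to}(\Gamma)=\{\alpha\to\beta\mid\alpha\in\Gamma,\beta\notin\Gamma\}$. $W^d_1$ is the set of pairs $\langle\Gamma,\Delta\rangle$ of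 sets of formulas with $\Gamma$ $\vdash_1$-closed, $\{\bot\}\cup\neg(\Gamma)\cup{\to}(\Gamma)\subseteq\Delta$, and $\Delta$ $\vdash_1$-downward closed and closed under $\lor$; $W^d_2$ is defined likewise with $\vdash_2$ and additionally $\Gamma\cap\Delta=\emptyset$. $\mathfrak M^d_k=\langle W^d_k,R^d_k,V^d_k\rangle$ with $\langle\Gamma_1,\Delta_1\rangle R^d_k\langle\Gamma_2,\Delta_2\rangle$ iff $\Gamma_1\cap\Delta_2=\emptyset$, and $V^d_k(p)=\{\langle\Gamma,\Delta\rangle\mid p\in\Gamma\}$. For a formula $\gamma$ and set $\Gamma$, $I^\gamma_k(\Gamma)=\{\varphi\mid\exists n\ge1,\ \alpha_1..\alpha_n\in\Gamma,\ \beta_1..\beta_n\notin\Gamma:\ \varphi\vdash_k(\alpha_1\to\beta_1)\lor\dots\lor(\alpha_n\to\beta_n)\lor\gamma\}$. $W^b_1=\{\langle\Gamma,I^\gamma_1(\Gamma)\rangle\mid\gamma\in Form,\ \Gamma\ \vdash_1\text{ -closed},\ \bot\notin\Gamma\}$ and $W^b_2=\{\langle\Gamma,I^\gamma_2(\Gamma)\rangle\mid\gamma\in Form,\ \Gamma\ \vdash_2\text{ -closed},\ \bot\notin\Gamma,\ \Gamma\cap I^\gamma_2(\Gamma)=\emptyset\}$; one has $W^b_k\subseteq W^d_k$. -}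

module Defs where

open import Level using (Level; Lift; lift) renaming (suc to lsuc; zero to lzero)
open import Data.Nat using (ℕ; zero; suc)
open import Data.Fin using (Fin; zero; suc)
open import Data.Product using (Σ; _×_; _,_; proj₁; proj₂)
open import Data.Sum using (_⊎_)
open import Data.Empty using (⊥)
open import Data.Unit using (⊤)
open import Data.List using (List; []; _∷_; _++_; tabulate)
open import Data.List.Membership.Propositional using (_∈_)
open import Data.List.Relation.Unary.All using (All)
open import Relation.Binary.PropositionalEquality using (_≡_)
open import Relation.Nullary using (¬_)

infixr 6 _∧_
infixr 5 _∨_
infixr 4 _⇒_

data Form : Set where
  var    : ℕ → Form
  falsum : Form
  _∧_    : Form → Form → Form
  _∨_    : Form → Form → Form
  _⇒_    : Form → Form → Form

neg : Form → Form
neg α = α ⇒ falsum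

top : Form
top = falsum ⇒ falsum

⋀ : ∀ {n} → (Fin (suc n) → Form) → Form
⋀ {zero}  f = f zero
⋀ {suc n} f = f zero ∧ ⋀ (λ j → f (suc j))

⋁ : ∀ {n} → (Fin (suc n) → Form) → Form
⋁ {zero}  f = f zero
⋁ {suc n} f = f zero ∨ ⋁ (λ j → f (suc j))

⋀L : List Form → Form
⋀L []           = top
⋀L (a ∷ [])     = a
⋀L (a ∷ b ∷ as) = a ∧ ⋀L (b ∷ as)

-- i-formulas  Δ ⊐ Θ  (finite sets represented by lists, identified up to
-- having the same elements via the rule i-ext below)

infix 3 _⊐_
record IForm : Set where
  constructor _⊐_
  field
    ante : List Form
    succ : List Form

_≈L_ : List Form → List Form → Set
Δ ≈L Δ' = ∀ x → (x ∈ Δ → x ∈ Δ') × (x ∈ Δ' → x ∈ Δ)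

-- plain = ⊩₁ ;  withRefl γ = ⊩₂^γ
data Mode : Set where
  plain    : Mode
  withRefl : Form → Mode

data _⊩⟨_⟩_ (Γ : IForm → Set) : Mode → IForm → Set where
  i-hyp  : ∀ {m x} → Γ x → Γ ⊩⟨ m ⟩ x
  i-A    : ∀ {m Δ Θ x} → x ∈ Δ → x ∈ Θ → Γ ⊩⟨ m ⟩ (Δ ⊐ Θ)
  i-cut  : ∀ {m Δ₁ Θ₁ Δ₂ Θ₂ φ} →
           Γ ⊩⟨ m ⟩ (Δ₁ ⊐ (φ ∷ Θ₁)) → Γ ⊩⟨ m ⟩ ((φ ∷ Δ₂) ⊐ Θ₂) →
           Γ ⊩⟨ m ⟩ ((Δ₁ ++ Δ₂) ⊐ (Θ₁ ++ Θ₂))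
  i-∧L₁  : ∀ {m φ ψ} → Γ ⊩⟨ m ⟩ ((φ ∧ ψ) ∷ [] ⊐ φ ∷ [])
  i-∧L₂  : ∀ {m φ ψ} → Γ ⊩⟨ m ⟩ ((φ ∧ ψ) ∷ [] ⊐ ψ ∷ [])
  i-∧R   : ∀ {m φ ψ} → Γ ⊩⟨ m ⟩ (φ ∷ ψ ∷ [] ⊐ (φ ∧ ψ) ∷ [])
  i-refl : ∀ {γ n} (φs ψs : Fin (suc n) → Form) →
           Γ ⊩⟨ withRefl γ ⟩
             ((tabulate φs ++ (⋁ (λ j → φs j ⇒ ψs j) ∨ γ) ∷ []) ⊐ tabulate ψs)
  i-ext  : ∀ {m Δ Θ Δ' Θ'} → Γ ⊩⟨ m ⟩ (Δ ⊐ Θ) → Δ ≈L Δ' → Θ ≈L Θ' →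
           Γ ⊩⟨ m ⟩ (Δ' ⊐ Θ')

iγ : Form → (Form → Set) → IForm → Set
iγ γ Γ (Δ ⊐ Θ) =
  Σ ℕ λ n → Σ (Fin (suc n) → Form) λ φs → Σ (Fin (suc n) → Form) λ ψs →
    Γ (⋁ (λ j → φs j ⇒ ψs j) ∨ γ) × Δ ≡ tabulate φs × Θ ≡ tabulate ψs

data Logic : Set where
  L1 L2 : Logic

mode : Logic → Form → Mode
mode L1 γ = plain
mode L2 γ = withRefl γ

data Der (k : Logic) : Form → Form → Set where
  ax    : ∀ {α} → Der k α α
  cut   : ∀ {α β γ} → Der k α β → Der k β γ → Der k α γ
  bot   : ∀ {α} → Der k falsum α
  ∧R    : ∀ {χ α β} → Der k χ α → Der k χ β → Der k χ (α ∧ β)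
  ∧L₁   : ∀ {α β} → Der k (α ∧ β) α
  ∧L₂   : ∀ {α β} → Der k (α ∧ β) β
  ∨R₁   : ∀ {α β} → Der k α (α ∨ β)
  ∨R₂   : ∀ {α β} → Der k β (α ∨ β)
  ∨L    : ∀ {α β χ} → Der k α χ → Der k β χ → Der k (α ∨ β) χ
  DT₀   : ∀ {α β χ} → Der k α β → Der k χ (α ⇒ β)
  ⇒∧    : ∀ {α β γ} → Der k ((α ⇒ β) ∧ (α ⇒ γ)) (α ⇒ (β ∧ γ))
  ⇒tr   : ∀ {α β γ} → Der k ((α ⇒ β) ∧ (β ⇒ γ)) (α ⇒ γ)
  ⇒∨s   : ∀ {n} (α β ψ : Fin (suc n) → Form) (χ : Form) →
          Der k (⋁ (λ j → α j ⇒ β j) ∧ ⋀ (λ j → (ψ j ∧ β j) ⇒ χ))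
                (⋀ (λ j → ψ j ∧ α j) ⇒ χ)
  ¬¬I   : ∀ {α} → Der k α (neg (neg α))
  abs   : ∀ {α} → k ≡ L1 → Der k (α ∧ neg α) falsum
  refl₁ : ∀ {n} (α β ψ : Fin (suc n) → Form) (χ : Form) → k ≡ L2 →
          (∀ j → Der k (ψ j ∧ β j) χ) →
          Der k (⋀ (λ j → ψ j ∧ α j) ∧ ⋁ (λ j → α j ⇒ β j)) χ
  refl₂ : ∀ {n} (α β ψ : Fin (suc n) → Form) (χ : Form) → k ≡ L2 →
          Der k (⋀ (λ j → (ψ j ∧ β j) ⇒ χ))
                ((⋀ (λ j → ψ j ∧ α j) ∧ ⋁ (λ j → α j ⇒ β j)) ⇒ χ)
  prop  : ∀ {α γ} →
          iγ γ (λ φ → Der k α φ) ⊩⟨ mode k γ ⟩ (top ∷ [] ⊐ falsum ∷ []) →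
          Der k α γ

SDer : Logic → (Form → Set) → Form → Set
SDer k Γ α = Σ (List Form) λ Γ₀ → All Γ Γ₀ × Der k (⋀L Γ₀) α

Closed : Logic → (Form → Set) → Set
Closed k Γ = ∀ α → SDer k Γ α → Γ α

DownClosed : Logic → (Form → Set) → Set
DownClosed k Δ = ∀ α β → Δ β → Der k α β → Δ α

∨Closed : (Form → Set) → Set
∨Closed Δ = ∀ α β → Δ α → Δ β → Δ (α ∨ β)

Disj : Logic → (Form → Set) → (Form → Set) → Set
Disj L1 Γ Δ = ⊤
Disj L2 Γ Δ = ∀ α → Γ α → Δ α → ⊥

World : Set₁
World = (Form → Set) × (Form → Set)

WD : Logic → World → Set
WD k (Γ , Δ) =
  Closed k Γ × Δ falsum × (∀ α → Γ α → Δ (neg α)) ×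
  (∀ α β → Γ α → ¬ Γ β → Δ (α ⇒ β)) ×
  DownClosed k Δ × ∨Closed Δ × Disj k Γ Δ

I : Logic → Form → (Form → Set) → Form → Set
I k γ Γ φ =
  Σ ℕ λ n → Σ (Fin (suc n) → Form) λ αs → Σ (Fin (suc n) → Form) λ βs →
    (∀ j → Γ (αs j)) × (∀ j → ¬ Γ (βs j)) ×
    Der k φ (⋁ (λ j → αs j ⇒ βs j) ∨ γ)

WB : Logic → World → Set
WB k (Γ , Δ) =
  Σ Form λ γ → (∀ φ → (Δ φ → I k γ Γ φ) × (I k γ Γ φ → Δ φ)) ×
    Closed k Γ × ¬ Γ falsum × Disj k Γ (I k γ Γ)

Rd : World → World → Set
Rd (Γ₁ , _) (_ , Δ₂) = ∀ φ → Γ₁ φ → Δ₂ φ → ⊥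

module Frame {a : Level} {W : Set a} (R : W → W → Set a) where

  Subset : Set (lsuc a)
  Subset = W → Set a

  □ : Subset → Subset
  □ X w = ∀ v → R w v → X v

  ◇ : Subset → Subset
  ◇ X w = ¬ □ (λ v → ¬ X v) w

  ◇⁻¹ : Subset → Subset
  ◇⁻¹ X w = Σ W λ x → X x × R x w

  ∅ : Subset
  ∅ _ = Lift a ⊥

  ⟪_⟫ : W → Subset
  ⟪ w ⟫ v = v ≡ w

  _≐_ : Subset → Subset → Set a
  X ≐ Y = ∀ w → (X w → Y w) × (Y w → X w)

  InFP : Subset → Set (lsuc a)
  InFP Y = Σ Subset λ X → Y ≐ □ X

  ⟦_⟧ : Form → (ℕ → Subset) → Subset
  ⟦ var p ⟧ V   = V p
  ⟦ falsum ⟧ V  = □ ∅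
  ⟦ α ∧ β ⟧ V w = ⟦ α ⟧ V w × ⟦ β ⟧ V w
  ⟦ α ⇒ β ⟧ V   = □ (λ v → ¬ ⟦ α ⟧ V v ⊎ ⟦ β ⟧ V v)
  ⟦ α ∨ β ⟧ V   = □ (◇⁻¹ (λ v → ⟦ α ⟧ V v ⊎ ⟦ β ⟧ V v))

  PseudoReflexive : Set a
  PseudoReflexive = ∀ w → □ ∅ w ⊎ ◇ (□ (◇⁻¹ ⟪ w ⟫)) w

  PseudoSymmetric : Set a
  PseudoSymmetric = ∀ w → □ (◇ (□ (◇⁻¹ ⟪ w ⟫))) w

  Reflexive : Set a
  Reflexive = ∀ w → R w w

Car : (World → Set₁) → Set₁
Car W = Σ World W

SubR : (W : World → Set₁) → Car W → Car W → Set₁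
SubR W w v = Lift _ (Rd (proj₁ w) (proj₁ v))

SubV : (W : World → Set₁) → ℕ → Car W → Set₁
SubV W p w = Lift _ (proj₁ (proj₁ w) (var p))

∣_∣ : Form → (W : World → Set₁) → Car W → Set₁
∣ α ∣ W w = Lift _ (proj₁ (proj₁ w) α)

-- A canonical-model argument. Points of W^b_k ⊆ W are produced by a Lindenbaum construction
-- for ⊩, run along an enumeration of formulas with excluded middle deciding each step: a pair
-- ⟨L, R⟩ refuted by no derivable Δ ⊐ Θ with Δ ⊆ L and Θ ⊆ R extends to a saturated P ⊇ L
-- disjoint from R, and ⟨P, I^γ_k(P)⟩ is then in W^b_k. Three instances carry the truth lemma:
-- if γ ∉ Γ_w, compactness of ⊩ and the rule (Prop) make ⟨{⊤}, {⊥}⟩ consistent over i_γ(Γ_w),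
-- giving a successor v with γ ∈ Δ_v; if α → β ∉ Γ_w, soundness of ⊩ for closed theories gives a
-- successor containing α but not β; if α ∉ Δ_v, soundness of ⊩ for ⊢ gives a predecessor
-- containing α. The first also shows |α|_W = □{v | α ∉ Δ_v}. For w R v, extending Γ_w over
-- i_⊥(Γ_v) is consistent by (¬¬I), which gives a successor u of v with Γ_w ⊆ Γ_u and hence
-- pseudo-symmetry. For k = 1, either ⊥ ∈ Γ_w and w has no successors, or (Abs) makes the same
-- extension consistent at v = w. For k = 2, Γ ∩ Δ = ∅ is reflexivity.

module Submission where

open import Defs
open import Level using (Lift; lift; lower) renaming (suc to lsuc; zero to lzero)
open import Data.Nat using (ℕ; zero; suc; _+_; _≤_; _⊔_; z≤n; s≤s; _≤′_; ≤′-refl; ≤′-step)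
open import Data.Nat.Properties using (≤-refl; +-suc; +-identityʳ; m≤m⊔n; m≤n⊔m; m⊔n≤o⇒m≤o; m⊔n≤o⇒n≤o; ≤⇒≤′)
open import Data.Fin using (Fin; zero; suc)
open import Data.Product using (Σ; ∃; ∃₂; _×_; _,_; proj₁; proj₂; uncurry)
open import Data.Sum as Sum using (_⊎_; inj₁; inj₂; [_,_]′)
open import Data.Empty using (⊥; ⊥-elim)
open import Data.Unit using (tt)
open import Data.List using (List; []; _∷_; _++_; [_]; tabulate; filter)
open import Data.List.Membership.Propositional using (_∈_)
open import Data.List.Membership.Propositional.Properties using (∈-++⁺ˡ; ∈-++⁺ʳ; ∈-filter⁺; ∈-filter⁻)
open import Data.List.Relation.Unary.Any using (here; there)
open import Data.List.Relation.Unary.All as All using (All; []; _∷_)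
open import Data.List.Relation.Unary.All.Properties as All using ()
open import Function using (_∘_; id)
open import Relation.Binary.PropositionalEquality using (_≡_; refl; sym; cong; cong₂; subst)
open import Relation.Nullary using (¬_; Dec; yes; no)
open import Relation.Nullary.Decidable using (map′)
open import Relation.Unary using (_⊆_; _∪_; ∁; ｛_｝)
open import Axiom.ExcludedMiddle using (ExcludedMiddle)

⋁L : List Form → Form
⋁L []       = falsum
⋁L (θ ∷ Θ) = θ ∨ ⋁L Θ

module _ {k : Logic} where

  ⊢⊤ : ∀ {χ} → Der k χ top
  ⊢⊤ = DT₀ ax

  ∨⊥-elim : ∀ {α} → Der k (α ∨ falsum) α
  ∨⊥-elim = ∨L ax bot

  ⋀-intro : ∀ {χ n} {f : Fin (suc n) → Form} → (∀ j → Der k χ (f j)) → Der k χ (⋀ f)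
  ⋀-intro {n = zero}  h = h zero
  ⋀-intro {n = suc n} h = ∧R (h zero) (⋀-intro (h ∘ suc))

  ⋀L-elim : ∀ {x Γ₀} → x ∈ Γ₀ → Der k (⋀L Γ₀) x
  ⋀L-elim {Γ₀ = _ ∷ []}    (here refl) = ax
  ⋀L-elim {Γ₀ = _ ∷ _ ∷ _} (here refl) = ∧L₁
  ⋀L-elim {Γ₀ = _ ∷ _ ∷ _} (there x∈) = cut ∧L₂ (⋀L-elim x∈)

  ⋁L-intro : ∀ {x Θ} → x ∈ Θ → Der k x (⋁L Θ)
  ⋁L-intro (here refl) = ∨R₁
  ⋁L-intro (there x∈)  = cut (⋁L-intro x∈) ∨R₂

⋀L-closed : {P : Form → Set} → P top → (∀ {a b} → P a → P b → P (a ∧ b)) →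
            ∀ {Γ₀} → All P Γ₀ → P (⋀L Γ₀)
⋀L-closed ⊤∈P ∧-closed []            = ⊤∈P
⋀L-closed ⊤∈P ∧-closed (p ∷ [])      = p
⋀L-closed ⊤∈P ∧-closed (p ∷ q ∷ ps) = ∧-closed p (⋀L-closed ⊤∈P ∧-closed (q ∷ ps))

module ClosedTheory {k : Logic} {Γ : Form → Set} (closed : Closed k Γ) where

  ∈-⊢ : ∀ {a b} → Γ a → Der k a b → Γ b
  ∈-⊢ {a} a∈ d = closed _ ([ a ] , a∈ ∷ [] , d)

  ∈-theorem : ∀ {b} → Der k top b → Γ b
  ∈-theorem d = closed _ ([] , [] , d)

  ∈-∧ : ∀ {a b} → Γ a → Γ b → Γ (a ∧ b)
  ∈-∧ {a} {b} a∈ b∈ = closed _ (a ∷ b ∷ [] , a∈ ∷ b∈ ∷ [] , ax)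

  ∈-⋀ : ∀ {n} {f : Fin (suc n) → Form} → (∀ j → Γ (f j)) → Γ (⋀ f)
  ∈-⋀ {zero}  h = h zero
  ∈-⋀ {suc n} h = ∈-∧ (h zero) (∈-⋀ (h ∘ suc))

  ∈-⋀L : ∀ {Γ₀} → All Γ Γ₀ → Γ (⋀L Γ₀)
  ∈-⋀L = ⋀L-closed (∈-theorem ax) ∈-∧

  ∈-⇒ : ∀ {a b} → Der k a b → Γ (a ⇒ b)
  ∈-⇒ d = ∈-theorem (DT₀ d)

  ∈-⇒-antitone : ∀ {a b c} → Der k a b → Γ (b ⇒ c) → Γ (a ⇒ c)
  ∈-⇒-antitone d b⇒c = ∈-⊢ (∈-∧ (∈-⇒ d) b⇒c) ⇒tr

≈L-refl : ∀ {Δ} → Δ ≈L Δ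
≈L-refl x = id , id

All-≈L : ∀ {P : Form → Set} {Δ Δ′} → Δ ≈L Δ′ → All P Δ′ → All P Δ
All-≈L e a = All.tabulate (λ x∈ → All.lookup a (proj₁ (e _) x∈))

⊩-mono : ∀ {H H′ m x} → H ⊆ H′ → H ⊩⟨ m ⟩ x → H′ ⊩⟨ m ⟩ x
⊩-mono H⊆ (i-hyp h)       = i-hyp (H⊆ h)
⊩-mono H⊆ (i-A p q)       = i-A p q
⊩-mono H⊆ (i-cut d₁ d₂)   = i-cut (⊩-mono H⊆ d₁) (⊩-mono H⊆ d₂)
⊩-mono H⊆ i-∧L₁           = i-∧L₁
⊩-mono H⊆ i-∧L₂           = i-∧L₂
⊩-mono H⊆ i-∧R            = i-∧R
⊩-mono H⊆ (i-refl φs ψs)  = i-refl φs ψs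
⊩-mono H⊆ (i-ext d e₁ e₂) = i-ext (⊩-mono H⊆ d) e₁ e₂

-- Unlike the paper's i-formulas, Δ ⊐ Θ may have an empty side; derivations from hypotheses with
-- non-empty sides have non-empty sides, so a refutation of ⟨{a}, {b}⟩ really derives {a} ⊐ {b}.
NonEmptySides : IForm → Set
NonEmptySides (Δ ⊐ Θ) = ∃ (_∈ Δ) × ∃ (_∈ Θ)

⊩-nonEmpty : ∀ {H m x} → (∀ {y} → H y → NonEmptySides y) → H ⊩⟨ m ⟩ x → NonEmptySides x
⊩-nonEmpty ne (i-hyp h)       = ne h
⊩-nonEmpty ne (i-A p q)       = (_ , p) , (_ , q)
⊩-nonEmpty ne (i-cut {Θ₁ = Θ₁} d₁ d₂) with ⊩-nonEmpty ne d₁ | ⊩-nonEmpty ne d₂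
... | (_ , p) , _ | _ , (_ , q) = (_ , ∈-++⁺ˡ p) , (_ , ∈-++⁺ʳ Θ₁ q)
⊩-nonEmpty ne i-∧L₁           = (_ , here refl) , (_ , here refl)
⊩-nonEmpty ne i-∧L₂           = (_ , here refl) , (_ , here refl)
⊩-nonEmpty ne i-∧R            = (_ , here refl) , (_ , here refl)
⊩-nonEmpty ne (i-refl φs ψs)  = (_ , here refl) , (_ , here refl)
⊩-nonEmpty ne (i-ext d e₁ e₂) with ⊩-nonEmpty ne d
... | (_ , p) , (_ , q) = (_ , proj₁ (e₁ _) p) , (_ , proj₁ (e₂ _) q)

iγ-nonEmpty : ∀ {γ Γ y} → iγ γ Γ y → NonEmptySides y
iγ-nonEmpty (_ , φs , ψs , _ , refl , refl) = (φs zero , here refl) , (ψs zero , here refl)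

≈L-singleton : ∀ {a Δ} → ∃ (_∈ Δ) → All ｛ a ｝ Δ → Δ ≈L [ a ]
≈L-singleton {Δ = Δ} (x , x∈) all-a y =
  (λ y∈ → here (sym (All.lookup all-a y∈))) ,
  (λ { (here refl) → subst (_∈ Δ) (sym (All.lookup all-a x∈)) x∈ })

⊩-singleton : ∀ {H m a b Δ Θ} → (∀ {y} → H y → NonEmptySides y) →
              H ⊩⟨ m ⟩ (Δ ⊐ Θ) → All ｛ a ｝ Δ → All ｛ b ｝ Θ → H ⊩⟨ m ⟩ ([ a ] ⊐ [ b ])
⊩-singleton ne d all-a all-b with ⊩-nonEmpty ne d
... | Δ≠[] , Θ≠[] = i-ext d (≈L-singleton Δ≠[] all-a) (≈L-singleton Θ≠[] all-b)

iγ-antitone : ∀ {k γ θ θ′} → Der k θ θ′ → iγ γ (Der k θ′) ⊆ iγ γ (Der k θ)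
iγ-antitone d (n , φs , ψs , ⊢⋁ , e₁ , e₂) = n , φs , ψs , cut d ⊢⋁ , e₁ , e₂

⊩-compact : ∀ {k γ Γ m x} → Closed k Γ → iγ γ Γ ⊩⟨ m ⟩ x → ∃ λ θ → Γ θ × iγ γ (Der k θ) ⊩⟨ m ⟩ x
⊩-compact {k} {γ} {Γ} closed = compact
  where
  open ClosedTheory closed
  compact : ∀ {m x} → iγ γ Γ ⊩⟨ m ⟩ x → ∃ λ θ → Γ θ × iγ γ (Der k θ) ⊩⟨ m ⟩ x
  compact (i-hyp (n , φs , ψs , ⋁∈ , e₁ , e₂)) = _ , ⋁∈ , i-hyp (n , φs , ψs , ax , e₁ , e₂)
  compact (i-cut d₁ d₂) with compact d₁ | compact d₂
  ... | θ₁ , θ₁∈ , d₁′ | θ₂ , θ₂∈ , d₂′ =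
    θ₁ ∧ θ₂ , ∈-∧ θ₁∈ θ₂∈ , i-cut (⊩-mono (iγ-antitone ∧L₁) d₁′) (⊩-mono (iγ-antitone ∧L₂) d₂′)
  compact (i-ext d e₁ e₂) with compact d
  ... | θ , θ∈ , d′ = θ , θ∈ , i-ext d′ e₁ e₂
  compact (i-A p q)      = top , ∈-theorem ax , i-A p q
  compact i-∧L₁          = top , ∈-theorem ax , i-∧L₁
  compact i-∧L₂          = top , ∈-theorem ax , i-∧L₂
  compact i-∧R           = top , ∈-theorem ax , i-∧R
  compact (i-refl φs ψs) = top , ∈-theorem ax , i-refl φs ψs

refl-sequent : ∀ {n} → Form → (φs ψs : Fin (suc n) → Form) → IForm
refl-sequent γ φs ψs = (tabulate φs ++ [ ⋁ (λ j → φs j ⇒ ψs j) ∨ γ ]) ⊐ tabulate ψs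

mode-falsum-refl : ∀ k {γ} → mode k falsum ≡ withRefl γ → k ≡ L2 × γ ≡ falsum
mode-falsum-refl L2 refl = refl , refl

-- Δ ⊐ Θ read as a rule for E: from ψ ⊢ δ for all δ ∈ Δ and E (ψ ∧ θ) χ for all θ ∈ Θ, infer E ψ χ.
-- Any E antitone in its first argument validates the structural and ∧-rules of ⊩; the cases of
-- interest are E = ⊢ and E ψ χ = (ψ → χ ∈ Γ) for a closed theory Γ.
Valid : Logic → (Form → Form → Set) → IForm → Set
Valid k E (Δ ⊐ Θ) = ∀ ψ χ → All (Der k ψ) Δ → All (λ θ → E (ψ ∧ θ) χ) Θ → E ψ χ

refl-antecedent : ∀ {k ψ n} {φs ψs : Fin (suc n) → Form} →
                  All (Der k ψ) (tabulate φs ++ [ ⋁ (λ j → φs j ⇒ ψs j) ∨ falsum ]) →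
                  Der k ψ (⋀ (λ j → ψ ∧ φs j) ∧ ⋁ (λ j → φs j ⇒ ψs j))
refl-antecedent {φs = φs} a with All.++⁻ (tabulate φs) a
... | ⊢φs , ⊢⋁ ∷ [] = ∧R (⋀-intro (λ j → ∧R ax (All.tabulate⁻ {f = φs} ⊢φs j))) (cut ⊢⋁ ∨⊥-elim)

module Soundness {k : Logic} {H : IForm → Set} (E : Form → Form → Set)
  (E-⊢ : ∀ {φ ψ χ} → Der k φ ψ → E ψ χ → E φ χ)
  (hyp-valid : ∀ {y} → H y → Valid k E y)
  (refl-valid : k ≡ L2 → ∀ {n} (φs ψs : Fin (suc n) → Form) → Valid k E (refl-sequent falsum φs ψs))
  where

  private
    valid : ∀ {m x} → (∀ {γ} → m ≡ withRefl γ → k ≡ L2 × γ ≡ falsum) → H ⊩⟨ m ⟩ x → Valid k E x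
    valid c (i-hyp h) = hyp-valid h
    valid c (i-A x∈Δ x∈Θ) ψ χ ⊢Δ EΘ = E-⊢ (∧R ax (All.lookup ⊢Δ x∈Δ)) (All.lookup EΘ x∈Θ)
    valid c (i-cut {Δ₁ = Δ₁} {Θ₁} {φ = φ} d₁ d₂) ψ χ ⊢Δ EΘ with All.++⁻ Δ₁ ⊢Δ | All.++⁻ Θ₁ EΘ
    ... | ⊢Δ₁ , ⊢Δ₂ | EΘ₁ , EΘ₂ = valid c d₁ ψ χ ⊢Δ₁ (E-ψ∧φ ∷ EΘ₁)
      where
      E-ψ∧φ : E (ψ ∧ φ) χ
      E-ψ∧φ = valid c d₂ _ χ (∧L₂ ∷ All.map (cut ∧L₁) ⊢Δ₂) (All.map (E-⊢ (∧R (cut ∧L₁ ∧L₁) ∧L₂)) EΘ₂)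
    valid c i-∧L₁ ψ χ (⊢φ∧ψ ∷ []) (E ∷ []) = E-⊢ (∧R ax (cut ⊢φ∧ψ ∧L₁)) E
    valid c i-∧L₂ ψ χ (⊢φ∧ψ ∷ []) (E ∷ []) = E-⊢ (∧R ax (cut ⊢φ∧ψ ∧L₂)) E
    valid c i-∧R ψ χ (⊢φ ∷ ⊢ψ ∷ []) (E ∷ []) = E-⊢ (∧R ax (∧R ⊢φ ⊢ψ)) E
    valid c (i-refl φs ψs) with c refl
    ... | k≡L2 , refl = refl-valid k≡L2 φs ψs
    valid c (i-ext d e₁ e₂) ψ χ ⊢Δ EΘ = valid c d ψ χ (All-≈L e₁ ⊢Δ) (All-≈L e₂ EΘ)

  sound : ∀ {x} → H ⊩⟨ mode k falsum ⟩ x → Valid k E x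
  sound = valid (mode-falsum-refl k)

Sequents⊢ : Logic → IForm → Set
Sequents⊢ k x = ∃₂ λ φ ψ → Der k φ ψ × x ≡ ([ φ ] ⊐ [ ψ ])

⊩-sound-⊢ : ∀ {k x} → Sequents⊢ k ⊩⟨ mode k falsum ⟩ x → Valid k (Der k) x
⊩-sound-⊢ {k} = Soundness.sound (Der k) cut sequent-valid refl-valid
  where
  sequent-valid : ∀ {y} → Sequents⊢ k y → Valid k (Der k) y
  sequent-valid (_ , _ , d , refl) ψ χ (⊢φ ∷ []) (⊢χ ∷ []) = cut (∧R ax (cut ⊢φ d)) ⊢χ
  refl-valid : k ≡ L2 → ∀ {n} (φs ψs : Fin (suc n) → Form) → Valid k (Der k) (refl-sequent falsum φs ψs)
  refl-valid k≡L2 φs ψs ψ χ ⊢Δ ⊢Θ =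
    cut (refl-antecedent ⊢Δ) (refl₁ φs ψs (λ _ → ψ) χ k≡L2 (All.tabulate⁻ {f = ψs} ⊢Θ))

⊩-sound-∈ : ∀ {k Γ x} → Closed k Γ → iγ falsum Γ ⊩⟨ mode k falsum ⟩ x → Valid k (λ ψ χ → Γ (ψ ⇒ χ)) x
⊩-sound-∈ {k} {Γ} closed = Soundness.sound _ ∈-⇒-antitone hyp-valid refl-valid
  where
  open ClosedTheory closed
  hyp-valid : ∀ {y} → iγ falsum Γ y → Valid k (λ ψ χ → Γ (ψ ⇒ χ)) y
  hyp-valid (_ , φs , ψs , ⋁∨⊥∈ , refl , refl) ψ χ ⊢Δ ∈Θ =
    ∈-⇒-antitone (⋀-intro (λ j → ∧R ax (All.tabulate⁻ {f = φs} ⊢Δ j)))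
      (∈-⊢ (∈-∧ (∈-⊢ ⋁∨⊥∈ ∨⊥-elim) (∈-⋀ (All.tabulate⁻ ∈Θ))) (⇒∨s φs ψs (λ _ → ψ) χ))
  refl-valid : k ≡ L2 → ∀ {n} (φs ψs : Fin (suc n) → Form) → Valid k (λ ψ χ → Γ (ψ ⇒ χ)) (refl-sequent falsum φs ψs)
  refl-valid k≡L2 φs ψs ψ χ ⊢Δ ∈Θ =
    ∈-⇒-antitone (refl-antecedent ⊢Δ) (∈-⊢ (∈-⋀ (All.tabulate⁻ {f = ψs} ∈Θ)) (refl₂ φs ψs (λ _ → ψ) χ k≡L2))

refuted⇒neg-⋀L : ∀ {k Γ Δ Θ} → Closed k Γ → iγ falsum Γ ⊩⟨ mode k falsum ⟩ (Δ ⊐ Θ) →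
                 All ｛ falsum ｝ Θ → Γ (neg (⋀L Δ))
refuted⇒neg-⋀L closed d ⊥s =
  ⊩-sound-∈ closed d _ falsum (All.tabulate ⋀L-elim) (All.map (λ { refl → ∈-⇒ ∧L₂ }) ⊥s)
  where open ClosedTheory closed

next : ℕ × ℕ → ℕ × ℕ
next (zero  , b) = suc b , zero
next (suc a , b) = a , suc b

unpair : ℕ → ℕ × ℕ
unpair zero    = zero , zero
unpair (suc n) = next (unpair n)

Reached : ℕ × ℕ → Set
Reached p = ∃ λ n → unpair n ≡ p

reached-next : ∀ {p} → Reached p → Reached (next p)
reached-next (n , eq) = suc n , cong next eq

reached-along-diagonal : ∀ a b → Reached (a + b , 0) → Reached (a , b)
reached-along-diagonal a zero    r = subst (λ d → Reached (d , 0)) (+-identityʳ a) r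
reached-along-diagonal a (suc b) r =
  reached-next (reached-along-diagonal (suc a) b (subst (λ d → Reached (d , 0)) (+-suc a b) r))

reached-diagonal-start : ∀ d → Reached (d , 0)
reached-diagonal-start zero    = 0 , refl
reached-diagonal-start (suc d) = reached-next (reached-along-diagonal 0 d (reached-diagonal-start d))

pair : ℕ → ℕ → ℕ
pair a b = proj₁ (reached-along-diagonal a b (reached-diagonal-start (a + b)))

unpair-pair : ∀ a b → unpair (pair a b) ≡ (a , b)
unpair-pair a b = proj₂ (reached-along-diagonal a b (reached-diagonal-start (a + b)))

-- The first argument of decode is fuel bounding the depth of the decoded formula.
mutual
  decode : ℕ → ℕ → Form
  decode zero    _ = falsum
  decode (suc f) n = decode-node f (unpair n)

  decode-node : ℕ → ℕ × ℕ → Form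
  decode-node f (0 , p)                     = var p
  decode-node f (1 , _)                     = falsum
  decode-node f (2 , m)                     = decode-binary _∧_ f m
  decode-node f (3 , m)                     = decode-binary _∨_ f m
  decode-node f (suc (suc (suc (suc _))) , m) = decode-binary _⇒_ f m

  decode-binary : (Form → Form → Form) → ℕ → ℕ → Form
  decode-binary op f m = op (decode f (proj₁ (unpair m))) (decode f (proj₂ (unpair m)))

encode : Form → ℕ
encode (var p) = pair 0 p
encode falsum  = pair 1 0
encode (α ∧ β) = pair 2 (pair (encode α) (encode β))
encode (α ∨ β) = pair 3 (pair (encode α) (encode β))
encode (α ⇒ β) = pair 4 (pair (encode α) (encode β))

depth : Form → ℕ
depth (var _) = 1
depth falsum  = 0
depth (α ∧ β) = suc (depth α ⊔ depth β)
depth (α ∨ β) = suc (depth α ⊔ depth β)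
depth (α ⇒ β) = suc (depth α ⊔ depth β)

decode-pair-binary : ∀ {op f t a b α β} → (∀ m → decode-node f (t , m) ≡ decode-binary op f m) →
                     decode f a ≡ α → decode f b ≡ β → decode (suc f) (pair t (pair a b)) ≡ op α β
decode-pair-binary {op} {f} {t} {a} {b} node-t a↦α b↦β
  rewrite unpair-pair t (pair a b) | node-t (pair a b) | unpair-pair a b = cong₂ op a↦α b↦β

decode-encode : ∀ φ f → depth φ ≤ f → decode f (encode φ) ≡ φ
decode-encode (var p) (suc f) _ rewrite unpair-pair 0 p = refl
decode-encode falsum zero    _ = refl
decode-encode falsum (suc f) _ rewrite unpair-pair 1 0 = refl
decode-encode (α ∧ β) (suc f) (s≤s le) = decode-pair-binary (λ _ → refl)
  (decode-encode α f (m⊔n≤o⇒m≤o _ _ le)) (decode-encode β f (m⊔n≤o⇒n≤o _ _ le))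
decode-encode (α ∨ β) (suc f) (s≤s le) = decode-pair-binary (λ _ → refl)
  (decode-encode α f (m⊔n≤o⇒m≤o _ _ le)) (decode-encode β f (m⊔n≤o⇒n≤o _ _ le))
decode-encode (α ⇒ β) (suc f) (s≤s le) = decode-pair-binary (λ _ → refl)
  (decode-encode α f (m⊔n≤o⇒m≤o _ _ le)) (decode-encode β f (m⊔n≤o⇒n≤o _ _ le))

enum : ℕ → Form
enum n = uncurry decode (unpair n)

enum-surjective : ∀ φ → ∃ λ n → enum n ≡ φ
enum-surjective φ = pair (depth φ) (encode φ) , eq
  where
  eq : enum (pair (depth φ) (encode φ)) ≡ φ
  eq rewrite unpair-pair (depth φ) (encode φ) = decode-encode φ (depth φ) ≤-refl

Consistent : (IForm → Set) → Mode → (Form → Set) → (Form → Set) → Set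
Consistent H m L R = ∀ {Δ Θ} → H ⊩⟨ m ⟩ (Δ ⊐ Θ) → All L Δ → All R Θ → ⊥

Saturated : (IForm → Set) → Mode → (Form → Set) → Set
Saturated H m P = Consistent H m P (∁ P)

module _ {Q : ℕ → Form → Set} (Q-step : ∀ n → Q n ⊆ Q (suc n)) where

  chain-mono : ∀ {a b} → a ≤ b → Q a ⊆ Q b
  chain-mono = go ∘ ≤⇒≤′
    where
    go : ∀ {a b} → a ≤′ b → Q a ⊆ Q b
    go ≤′-refl       = id
    go (≤′-step a≤b) = Q-step _ ∘ go a≤b

  chain-All : ∀ {xs} → All (λ x → ∃ λ n → Q n x) xs → ∃ λ N → All (Q N) xs
  chain-All []               = 0 , []
  chain-All ((n , q) ∷ qs) with chain-All qs
  ... | N , qs′ = n ⊔ N , chain-mono (m≤m⊔n n N) q ∷ All.map (chain-mono (m≤n⊔m n N)) qs′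

module Lindenbaum (decide : (A : Set) → Dec A) {H : IForm → Set} {m : Mode} where

  private
    without : Form → List Form → List Form
    without φ = filter (λ x → decide (¬ φ ≡ x))

    ≈L-pull : ∀ {φ} {xs : List Form} → φ ∈ xs → xs ≈L (φ ∷ without φ xs)
    ≈L-pull {φ} {xs} φ∈ x = pull , push
      where
      pull : x ∈ xs → x ∈ φ ∷ without φ xs
      pull x∈ with decide (φ ≡ x)
      ... | yes refl = here refl
      ... | no φ≢x   = there (∈-filter⁺ _ x∈ φ≢x)
      push : x ∈ φ ∷ without φ xs → x ∈ xs
      push (here refl) = φ∈
      push (there x∈)  = proj₁ (∈-filter⁻ _ x∈)

    All-without : ∀ {φ} {P : Form → Set} {xs} → All (｛ φ ｝ ∪ P) xs → All P (without φ xs)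
    All-without a = All.tabulate λ x∈ → let x∈xs , φ≢x = ∈-filter⁻ _ x∈ in
      [ ⊥-elim ∘ φ≢x , id ]′ (All.lookup a x∈xs)

    All-drop : ∀ {φ} {P : Form → Set} {xs} → ¬ φ ∈ xs → All (｛ φ ｝ ∪ P) xs → All P xs
    All-drop φ∉ a = All.tabulate λ x∈ → [ (λ { refl → ⊥-elim (φ∉ x∈) }) , id ]′ (All.lookup a x∈)

  -- A derivation refuting ⟨L, φ ∪ R⟩ and one refuting ⟨φ ∪ L, R⟩ cut on φ to refute ⟨L, R⟩.
  split : ∀ {L R} φ → Consistent H m L R → ¬ Consistent H m (｛ φ ｝ ∪ L) R → Consistent H m L (｛ φ ｝ ∪ R)
  split {L} {R} φ c nc {Δ₂} {Θ₂} d₂ a₂ r₂ = nc inner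
    where
    inner : Consistent H m (｛ φ ｝ ∪ L) R
    inner {Δ₁} {Θ₁} d₁ a₁ r₁ with decide (φ ∈ Θ₂) | decide (φ ∈ Δ₁)
    ... | no φ∉Θ₂  | _          = c d₂ a₂ (All-drop φ∉Θ₂ r₂)
    ... | yes _     | no φ∉Δ₁   = c d₁ (All-drop φ∉Δ₁ a₁) r₁
    ... | yes φ∈Θ₂ | yes φ∈Δ₁ =
      c (i-cut (i-ext d₂ ≈L-refl (≈L-pull φ∈Θ₂)) (i-ext d₁ (≈L-pull φ∈Δ₁) ≈L-refl))
        (All.++⁺ a₂ (All-without a₁)) (All.++⁺ (All-without r₂) r₁)

  extend : Form → (Form → Set) × (Form → Set) → (Form → Set) × (Form → Set)
  extend φ (L , R) with decide (Consistent H m (｛ φ ｝ ∪ L) R)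
  ... | yes _ = ｛ φ ｝ ∪ L , R
  ... | no _  = L , ｛ φ ｝ ∪ R

  extend-consistent : ∀ φ {L R} → Consistent H m L R → uncurry (Consistent H m) (extend φ (L , R))
  extend-consistent φ {L} {R} c with decide (Consistent H m (｛ φ ｝ ∪ L) R)
  ... | yes c′ = c′
  ... | no nc  = split φ c nc

  extend-grows : ∀ φ {L R} → L ⊆ proj₁ (extend φ (L , R)) × R ⊆ proj₂ (extend φ (L , R))
  extend-grows φ {L} {R} with decide (Consistent H m (｛ φ ｝ ∪ L) R)
  ... | yes _ = inj₂ , id
  ... | no _  = id , inj₂

  extend-decides : ∀ φ {L R} → proj₁ (extend φ (L , R)) φ ⊎ proj₂ (extend φ (L , R)) φ
  extend-decides φ {L} {R} with decide (Consistent H m (｛ φ ｝ ∪ L) R)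
  ... | yes _ = inj₁ (inj₁ refl)
  ... | no _  = inj₂ (inj₁ refl)

  lindenbaum : ∀ {L₀ R₀} → Consistent H m L₀ R₀ →
               Σ (Form → Set) λ P → Saturated H m P × L₀ ⊆ P × R₀ ⊆ ∁ P
  lindenbaum {L₀} {R₀} c₀ = Limit , saturated , (λ l → 0 , l) , R₀-excluded
    where
    stage : ℕ → (Form → Set) × (Form → Set)
    stage zero    = L₀ , R₀
    stage (suc n) = extend (enum n) (stage n)

    Lₙ Rₙ : ℕ → Form → Set
    Lₙ n = proj₁ (stage n)
    Rₙ n = proj₂ (stage n)

    Limit : Form → Set
    Limit x = ∃ λ n → Lₙ n x

    consistent : ∀ n → Consistent H m (Lₙ n) (Rₙ n)
    consistent zero    = c₀
    consistent (suc n) = extend-consistent (enum n) (consistent n)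

    L-step : ∀ n → Lₙ n ⊆ Lₙ (suc n)
    L-step n = proj₁ (extend-grows (enum n))
    R-step : ∀ n → Rₙ n ⊆ Rₙ (suc n)
    R-step n = proj₂ (extend-grows (enum n))

    decided : ∀ x → Limit x ⊎ ∃ λ n → Rₙ n x
    decided x with enum-surjective x
    ... | n , refl = Sum.map (suc n ,_) (suc n ,_) (extend-decides (enum n))

    saturated : Saturated H m Limit
    saturated d in-L out-L
      with chain-All L-step in-L
         | chain-All R-step (All.map (λ {x} x∉ → [ ⊥-elim ∘ x∉ , id ]′ (decided x)) out-L)
    ... | N₁ , in-L′ | N₂ , in-R =
      consistent (N₁ ⊔ N₂) d (All.map (chain-mono L-step (m≤m⊔n N₁ N₂)) in-L′)
                             (All.map (chain-mono R-step (m≤n⊔m N₁ N₂)) in-R)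

    R₀-excluded : R₀ ⊆ ∁ Limit
    R₀-excluded r (n , l) = consistent n (i-A (here refl) (here refl)) (l ∷ []) (chain-mono R-step {b = n} z≤n r ∷ [])

saturated-disjoint : ∀ k {γ H P} → Saturated H (mode k γ) P → (∀ {a b} → P a → Der k a b → P b) →
                     Disj k P (I k γ P)
saturated-disjoint L1 _ _ = tt
saturated-disjoint L2 sat ∈-⊢ _ φ∈ (_ , αs , βs , αs∈ , βs∉ , d) =
  sat (i-refl αs βs) (All.++⁺ (All.tabulate⁺ αs∈) (∈-⊢ φ∈ d ∷ [])) (All.tabulate⁺ βs∉)

Disj-L2-reflexive : ∀ {k Γ Δ} → k ≡ L2 → Disj k Γ Δ → Rd (Γ , Δ) (Γ , Δ)
Disj-L2-reflexive refl disjoint = disjoint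

module Canonical (em : ExcludedMiddle (lsuc lzero)) (k : Logic) (W : World → Set₁)
                 (wb : ∀ w → WB k w → W w) (wd : ∀ w → W w → WD k w) where

  decide : (A : Set) → Dec A
  decide A = map′ lower lift (em {Lift _ A})

  open Lindenbaum decide

  Point : Set₁
  Point = Car W

  Γ⟨_⟩ Δ⟨_⟩ : Point → Form → Set
  Γ⟨ w ⟩ = proj₁ (proj₁ w)
  Δ⟨ w ⟩ = proj₂ (proj₁ w)

  _⟶_ : Point → Point → Set
  w ⟶ v = Rd (proj₁ w) (proj₁ v)

  Γ-closed : ∀ w → Closed k Γ⟨ w ⟩
  Γ-closed (_ , w∈) = let closed , _ = wd _ w∈ in closed

  ⊥∈Δ : ∀ w → Δ⟨ w ⟩ falsum
  ⊥∈Δ (_ , w∈) = let _ , ⊥∈ , _ = wd _ w∈ in ⊥∈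

  ¬∈Δ : ∀ w {α} → Γ⟨ w ⟩ α → Δ⟨ w ⟩ (neg α)
  ¬∈Δ (_ , w∈) = let _ , _ , ¬∈ , _ = wd _ w∈ in ¬∈ _

  ⇒∈Δ : ∀ w {α β} → Γ⟨ w ⟩ α → ¬ Γ⟨ w ⟩ β → Δ⟨ w ⟩ (α ⇒ β)
  ⇒∈Δ (_ , w∈) = let _ , _ , _ , ⇒∈ , _ = wd _ w∈ in ⇒∈ _ _

  Δ-down : ∀ w {α β} → Δ⟨ w ⟩ β → Der k α β → Δ⟨ w ⟩ α
  Δ-down (_ , w∈) = let _ , _ , _ , _ , down , _ = wd _ w∈ in down _ _

  Δ-∨ : ∀ w {α β} → Δ⟨ w ⟩ α → Δ⟨ w ⟩ β → Δ⟨ w ⟩ (α ∨ β)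
  Δ-∨ (_ , w∈) = let _ , _ , _ , _ , _ , ∨∈ , _ = wd _ w∈ in ∨∈ _ _

  Γ∩Δ : ∀ w → Disj k Γ⟨ w ⟩ Δ⟨ w ⟩
  Γ∩Δ (_ , w∈) = let _ , _ , _ , _ , _ , _ , disjoint = wd _ w∈ in disjoint

  module Th (w : Point) = ClosedTheory (Γ-closed w)

  ⋁L-∈Δ : ∀ w {Θ} → All Δ⟨ w ⟩ Θ → Δ⟨ w ⟩ (⋁L Θ)
  ⋁L-∈Δ w []        = ⊥∈Δ w
  ⋁L-∈Δ w (θ∈ ∷ Θ⊆) = Δ-∨ w θ∈ (⋁L-∈Δ w Θ⊆)

  Embeds : (IForm → Set) → Form → Set
  Embeds H γ = ∀ {φ ψ} → Der k φ ψ → H ⊩⟨ mode k γ ⟩ ([ φ ] ⊐ [ ψ ])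

  iγ-embeds : ∀ {γ Γ} → Closed k Γ → Embeds (iγ γ Γ) γ
  iγ-embeds closed {φ} {ψ} d =
    i-hyp (0 , (λ _ → φ) , (λ _ → ψ) , ClosedTheory.∈-theorem closed (cut (DT₀ d) ∨R₁) , refl , refl)

  Sequents⊢-embed : Embeds (Sequents⊢ k) falsum
  Sequents⊢-embed d = i-hyp (_ , _ , d , refl)

  saturated-∈ : ∀ {H m P Δ b} → Saturated H m P → H ⊩⟨ m ⟩ (Δ ⊐ [ b ]) → All P Δ → P b
  saturated-∈ {P = P} {b = b} sat d Δ⊆P with decide (P b)
  ... | yes b∈ = b∈
  ... | no b∉  = ⊥-elim (sat d Δ⊆P (b∉ ∷ []))

  saturated-closed : ∀ {H γ P} → Embeds H γ → Saturated H (mode k γ) P → P top → Closed k P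
  saturated-closed emb sat ⊤∈P _ (_ , Γ₀⊆P , d) =
    saturated-∈ sat (emb d) (⋀L-closed ⊤∈P (λ a∈ b∈ → saturated-∈ sat i-∧R (a∈ ∷ b∈ ∷ [])) Γ₀⊆P ∷ [])

  saturated-world : ∀ {H γ L R} → Embeds H γ → Consistent H (mode k γ) L R → L top → R falsum →
                    Σ (Form → Set) λ P → Saturated H (mode k γ) P × L ⊆ P × R ⊆ ∁ P × W (P , I k γ P)
  saturated-world {γ = γ} emb c ⊤∈L ⊥∈R with lindenbaum c
  ... | P , sat , L⊆P , R∩P = P , sat , L⊆P , R∩P , wb _ (γ , (λ _ → id , id) , closed , R∩P ⊥∈R , disjoint)
    where
    closed : Closed k P
    closed = saturated-closed emb sat (L⊆P ⊤∈L)
    disjoint : Disj k P (I k γ P)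
    disjoint = saturated-disjoint k sat (ClosedTheory.∈-⊢ closed)

  R-saturated : ∀ w {γ P} → Saturated (iγ γ Γ⟨ w ⟩) (mode k γ) P → Rd (proj₁ w) (P , I k γ P)
  R-saturated w sat _ φ∈ (n , αs , βs , αs∈ , βs∉ , d) =
    sat (i-hyp (n , αs , βs , Th.∈-⊢ w φ∈ d , refl , refl)) (All.tabulate⁺ αs∈) (All.tabulate⁺ βs∉)

  successor : ∀ w γ {L R} → Consistent (iγ γ Γ⟨ w ⟩) (mode k γ) L R → L top → R falsum →
              Σ Point λ v → w ⟶ v × L ⊆ Γ⟨ v ⟩ × R ⊆ ∁ Γ⟨ v ⟩ × Δ⟨ v ⟩ γ
  successor w γ c ⊤∈L ⊥∈R with saturated-world (iγ-embeds (Γ-closed w)) c ⊤∈L ⊥∈R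
  ... | P , sat , L⊆P , R∩P , v∈ =
    ((P , I k γ P) , v∈) , R-saturated w sat , L⊆P , R∩P ,
    -- γ ⊢ (⊤ → ⊥) ∨ γ with ⊤ ∈ P and ⊥ ∉ P puts γ in I^γ_k(P)
    (0 , (λ _ → top) , (λ _ → falsum) , (λ _ → L⊆P ⊤∈L) , (λ _ → R∩P ⊥∈R) , ∨R₂)

  prop-consistent : ∀ w {γ} → ¬ Γ⟨ w ⟩ γ → Consistent (iγ γ Γ⟨ w ⟩) (mode k γ) ｛ top ｝ ｛ falsum ｝
  prop-consistent w γ∉ d ⊤s ⊥s with ⊩-compact (Γ-closed w) (⊩-singleton (iγ-nonEmpty {Γ = Γ⟨ w ⟩}) d ⊤s ⊥s)
  ... | θ , θ∈ , d′ = γ∉ (Th.∈-⊢ w θ∈ (prop d′))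

  □∉Δ⇒∈Γ : ∀ w {α} → (∀ v → w ⟶ v → ¬ Δ⟨ v ⟩ α) → Γ⟨ w ⟩ α
  □∉Δ⇒∈Γ w {α} h with decide (Γ⟨ w ⟩ α)
  ... | yes α∈ = α∈
  ... | no α∉ with successor w α (prop-consistent w α∉) refl refl
  ...   | v , wRv , _ , _ , α∈Δv = ⊥-elim (h v wRv α∈Δv)

  ⇒-consistent : ∀ w {α β} → ¬ Γ⟨ w ⟩ (α ⇒ β) →
                 Consistent (iγ falsum Γ⟨ w ⟩) (mode k falsum) (｛ top ｝ ∪ ｛ α ｝) (｛ falsum ｝ ∪ ｛ β ｝)
  ⇒-consistent w {α} {β} α⇒β∉ d L⊆ R⊆ =
    α⇒β∉ (⊩-sound-∈ (Γ-closed w) d α β (All.map α⊢ L⊆) (All.map ∧⇒β∈ R⊆))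
    where
    α⊢ : ｛ top ｝ ∪ ｛ α ｝ ⊆ Der k α
    α⊢ (inj₁ refl) = ⊢⊤
    α⊢ (inj₂ refl) = ax
    ∧⇒β∈ : ｛ falsum ｝ ∪ ｛ β ｝ ⊆ λ θ → Γ⟨ w ⟩ ((α ∧ θ) ⇒ β)
    ∧⇒β∈ (inj₁ refl) = Th.∈-⇒ w (cut ∧L₂ bot)
    ∧⇒β∈ (inj₂ refl) = Th.∈-⇒ w ∧L₂

  ⇒-from-successors : ∀ w {α β} → (∀ v → w ⟶ v → Γ⟨ v ⟩ α → Γ⟨ v ⟩ β) → Γ⟨ w ⟩ (α ⇒ β)
  ⇒-from-successors w {α} {β} h with decide (Γ⟨ w ⟩ (α ⇒ β))
  ... | yes α⇒β∈ = α⇒β∈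
  ... | no α⇒β∉ with successor w falsum (⇒-consistent w α⇒β∉) (inj₁ refl) (inj₁ refl)
  ...   | v , wRv , L⊆ , R∩ , _ = ⊥-elim (R∩ (inj₂ refl) (h v wRv (L⊆ (inj₂ refl))))

  ∉Δ-consistent : ∀ v {α} → ¬ Δ⟨ v ⟩ α → Consistent (Sequents⊢ k) (mode k falsum) (Der k α) Δ⟨ v ⟩
  ∉Δ-consistent v α∉ d ⊢Δ Θ⊆Δ =
    α∉ (Δ-down v (⋁L-∈Δ v Θ⊆Δ) (⊩-sound-⊢ d _ _ ⊢Δ (All.tabulate (λ θ∈ → cut ∧L₂ (⋁L-intro θ∈)))))

  ∉Δ⇒predecessor : ∀ v {α} → ¬ Δ⟨ v ⟩ α → Σ Point λ u → Γ⟨ u ⟩ α × u ⟶ v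
  ∉Δ⇒predecessor v α∉ with saturated-world Sequents⊢-embed (∉Δ-consistent v α∉) ⊢⊤ (⊥∈Δ v)
  ... | P , _ , L⊆P , R∩P , u∈ = ((P , I k falsum P) , u∈) , L⊆P ax , λ _ φ∈ φ∈Δ → R∩P φ∈Δ φ∈

  open Frame (SubR W)

  ⊆⇒□◇⁻¹ : ∀ {w u} → Γ⟨ w ⟩ ⊆ Γ⟨ u ⟩ → □ (◇⁻¹ ⟪ w ⟫) u
  ⊆⇒□◇⁻¹ {w} Γw⊆Γu _ uRx = w , refl , lift (λ φ φ∈ φ∈Δ → lower uRx φ (Γw⊆Γu φ∈) φ∈Δ)

  consistent⇒◇□◇⁻¹ : ∀ v w → Consistent (iγ falsum Γ⟨ v ⟩) (mode k falsum) Γ⟨ w ⟩ ｛ falsum ｝ →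
                     ◇ (□ (◇⁻¹ ⟪ w ⟫)) v
  consistent⇒◇□◇⁻¹ v w c no-u with successor v falsum c (Th.∈-theorem w ax) refl
  ... | u , vRu , Γw⊆Γu , _ = no-u u (lift vRu) (⊆⇒□◇⁻¹ {w} {u} Γw⊆Γu)

  V : ℕ → Point → Set₁
  V = SubV W

  mutual
    truth⁺ : ∀ α {w} → Γ⟨ w ⟩ α → ⟦ α ⟧ V w
    truth⁺ (var p) α∈ = lift α∈
    truth⁺ falsum ⊥∈ v wRv = lift (lower wRv falsum ⊥∈ (⊥∈Δ v))
    truth⁺ (α ∧ β) {w} α∧β∈ = truth⁺ α (Th.∈-⊢ w α∧β∈ ∧L₁) , truth⁺ β (Th.∈-⊢ w α∧β∈ ∧L₂)
    truth⁺ (α ⇒ β) α⇒β∈ v wRv with decide (Γ⟨ v ⟩ β)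
    ... | yes β∈ = inj₂ (truth⁺ β β∈)
    ... | no β∉  = inj₁ (λ a → lower wRv _ α⇒β∈ (⇒∈Δ v (truth⁻ α a) β∉))
    truth⁺ (α ∨ β) α∨β∈ v wRv with decide (Δ⟨ v ⟩ α) | decide (Δ⟨ v ⟩ β)
    ... | no α∉ | _ = let u , α∈ , uRv = ∉Δ⇒predecessor v α∉ in u , inj₁ (truth⁺ α α∈) , lift uRv
    ... | yes _ | no β∉ = let u , β∈ , uRv = ∉Δ⇒predecessor v β∉ in u , inj₂ (truth⁺ β β∈) , lift uRv
    ... | yes α∈Δ | yes β∈Δ = ⊥-elim (lower wRv _ α∨β∈ (Δ-∨ v α∈Δ β∈Δ))

    truth⁻ : ∀ α {w} → ⟦ α ⟧ V w → Γ⟨ w ⟩ α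
    truth⁻ (var p) a = lower a
    truth⁻ falsum {w} h = □∉Δ⇒∈Γ w λ v wRv _ → lower (h v (lift wRv))
    truth⁻ (α ∧ β) {w} (a , b) = Th.∈-∧ w (truth⁻ α a) (truth⁻ β b)
    truth⁻ (α ⇒ β) {w} h = ⇒-from-successors w λ v wRv α∈ →
      [ (λ ¬a → ⊥-elim (¬a (truth⁺ α α∈))) , truth⁻ β ]′ (h v (lift wRv))
    truth⁻ (α ∨ β) {w} h = □∉Δ⇒∈Γ w λ v wRv α∨β∈Δ →
      let u , a∨b , uRv = h v (lift wRv) in lower uRv _ (∨-∈ u a∨b) α∨β∈Δ
      where
      ∨-∈ : ∀ u → ⟦ α ⟧ V u ⊎ ⟦ β ⟧ V u → Γ⟨ u ⟩ (α ∨ β)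
      ∨-∈ u (inj₁ a) = Th.∈-⊢ u (truth⁻ α a) ∨R₁
      ∨-∈ u (inj₂ b) = Th.∈-⊢ u (truth⁻ β b) ∨R₂

  truth : ∀ α → ∣ α ∣ W ≐ ⟦ α ⟧ V
  truth α w = truth⁺ α ∘ lower , lift ∘ truth⁻ α

  ∣∣-InFP : ∀ α → InFP (∣ α ∣ W)
  ∣∣-InFP α = (λ v → Lift _ (¬ Δ⟨ v ⟩ α)) , λ w →
    (λ α∈ v wRv → lift (lower wRv α (lower α∈))) ,
    (λ h → lift (□∉Δ⇒∈Γ w λ v wRv → lower (h v (lift wRv))))

  pseudo-symmetric : PseudoSymmetric
  pseudo-symmetric w v wRv = consistent⇒◇□◇⁻¹ v w λ d Δ⊆Γw ⊥s →
    lower wRv _ (Th.∈-⊢ w (Th.∈-⋀L w Δ⊆Γw) ¬¬I) (¬∈Δ v (refuted⇒neg-⋀L (Γ-closed v) d ⊥s))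

  pseudo-reflexive : k ≡ L1 → PseudoReflexive
  pseudo-reflexive k≡L1 w with decide (Γ⟨ w ⟩ falsum)
  ... | yes ⊥∈ = inj₁ (truth⁺ falsum {w} ⊥∈)
  ... | no ⊥∉  = inj₂ (consistent⇒◇□◇⁻¹ w w λ d Δ⊆Γw ⊥s →
    ⊥∉ (Th.∈-⊢ w (Th.∈-∧ w (Th.∈-⋀L w Δ⊆Γw) (refuted⇒neg-⋀L (Γ-closed w) d ⊥s)) (abs k≡L1)))

  reflexive : k ≡ L2 → Reflexive
  reflexive k≡L2 w = lift (Disj-L2-reflexive k≡L2 (Γ∩Δ w))

lemma17 : ExcludedMiddle (lsuc lzero) →
    (k : Logic) (W : World → Set₁) →
    (∀ w → WB k w → W w) → (∀ w → W w → WD k w) →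
    ((α : Form) → Frame.InFP (SubR W) (∣ α ∣ W)) ×
    ((α : Form) → Frame._≐_ (SubR W) (∣ α ∣ W) (Frame.⟦_⟧ (SubR W) α (SubV W))) ×
    Frame.PseudoSymmetric (SubR W) ×
    (k ≡ L1 → Frame.PseudoReflexive (SubR W)) ×
    (k ≡ L2 → Frame.Reflexive (SubR W))
lemma17 em k W wb wd = ∣∣-InFP , truth , pseudo-symmetric , pseudo-reflexive , reflexive
  where open Canonical em k W wb wd
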